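{- Let $\Gamma=(x_i:A_i)_{1\le i\le n}$ be a context such that $\Gamma\vdash_{ps}$ holds. Then for all $i,j$ with $x_i=x_j$ we have $i=j$.
   Context: Types over a fixed countably infinite set of variables: $\star$ and $\mathrm{Hom}_A(t,u)$ for a type $A$ and variables $t,u$. Contexts are lists $x_1:A_1,\dots,x_n:A_n$; $FV(\Gamma)$ denotes the set of variables occurring in $\Gamma$. The judgments $\Gamma\vdash_{ps}$ and $\Gamma\vdash_{ps}x:A$ are generated by the rules: $x:\star\vdash_{ps}x:\star$; from $\Gamma\vdash_{ps}x:A$ infer $\Gamma,y:A,f:\mathrm{Hom}_A(x,y)\vdash_{ps}f:\mathrm{Hom}_A(x,y)$ provided $y,f\notin FV(\Gamma)$; from $\Gamma\vdash_{ps}f:\mathrm{Hom}_A(x,y)$ infer $\Gamma\vdash_{ps}y:A$; from $\Gamma\vdash_{ps}x:\star$ infer $\Gamma\vdash_{ps}$. -}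

module Defs where

open import Data.Nat using (ℕ)
open import Data.List using (List; []; _∷_; _++_; [_])
open import Data.List.Membership.Propositional using (_∈_)
open import Data.Product using (_×_; _,_)
open import Relation.Nullary using (¬_)
open import Relation.Binary.PropositionalEquality using (_≡_)

Var : Set
Var = ℕ

data Ty : Set where
  ⋆   : Ty
  Hom : Ty → Var → Var → Ty

-- Contexts x₁:A₁,…,xₙ:Aₙ as lists (leftmost = x₁), extended on the right.
Ctx : Set
Ctx = List (Var × Ty)

FVTy : Ty → List Var
FVTy ⋆ = []
FVTy (Hom A t u) = FVTy A ++ (t ∷ u ∷ [])

FV : Ctx → List Var
FV [] = []
FV ((x , A) ∷ Γ) = x ∷ (FVTy A ++ FV Γ)

data _⊢ps_∶_ : Ctx → Var → Ty → Set where
  ps-init : ∀ x → ((x , ⋆) ∷ []) ⊢ps x ∶ ⋆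
  ps-ext  : ∀ {Γ x A} y f → Γ ⊢ps x ∶ A → ¬ (y ∈ FV Γ) → ¬ (f ∈ FV Γ) → ¬ (y ≡ f) →
            ((Γ ++ [ (y , A) ]) ++ [ (f , Hom A x y) ]) ⊢ps f ∶ Hom A x y
  ps-tgt  : ∀ {Γ f A x y} → Γ ⊢ps f ∶ Hom A x y → Γ ⊢ps y ∶ A

data _⊢ps : Ctx → Set where
  ps-done : ∀ {Γ x} → Γ ⊢ps x ∶ ⋆ → Γ ⊢ps

-- Each extension step declares two variables fresh for the context, so the declared
-- names stay pairwise distinct; lookup in a list with pairwise distinct names is injective.

module Submission where

open import Defs
open import Data.Empty using (⊥-elim)
open import Data.Fin using (Fin; zero; suc)
open import Data.List using (List; []; _∷_; _++_; [_]; length; lookup)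
open import Data.List.Membership.Propositional using (_∈_)
open import Data.List.Membership.Propositional.Properties using (∈-++⁺ʳ; ∈-lookup)
open import Data.List.Relation.Unary.All as All using (All; []; _∷_)
open import Data.List.Relation.Unary.All.Properties using (++⁺)
open import Data.List.Relation.Unary.AllPairs using (AllPairs; []; _∷_)
import Data.List.Relation.Unary.AllPairs.Properties as AllPairs
open import Data.List.Relation.Unary.Any using (here; there)
open import Data.Product using (proj₁; _,_)
open import Function using (_on_)
open import Relation.Nullary using (¬_)
open import Relation.Binary.PropositionalEquality using (_≡_; _≢_; refl; sym; cong)

lookup-injective : ∀ {a b} {A : Set a} {B : Set b} (f : A → B) {xs : List A} →
  AllPairs (_≢_ on f) xs → (i j : Fin (length xs)) → f (lookup xs i) ≡ f (lookup xs j) → i ≡ j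
lookup-injective f (_ ∷ _)   zero    zero    _  = refl
lookup-injective f (x≢ ∷ _)  zero    (suc j) eq = ⊥-elim (All.lookup x≢ (∈-lookup j) eq)
lookup-injective f (x≢ ∷ _)  (suc i) zero    eq = ⊥-elim (All.lookup x≢ (∈-lookup i) (sym eq))
lookup-injective f (_ ∷ xs≢) (suc i) (suc j) eq = cong suc (lookup-injective f xs≢ i j eq)

DistinctNames : Ctx → Set
DistinctNames = AllPairs (_≢_ on proj₁)

fresh⇒names-≢ : ∀ {z} Γ → ¬ z ∈ FV Γ → All (λ d → proj₁ d ≢ z) Γ
fresh⇒names-≢ []             _   = []
fresh⇒names-≢ ((x , A) ∷ Γ) z∉ =
  (λ { refl → z∉ (here refl) }) ∷ fresh⇒names-≢ Γ (λ z∈ → z∉ (there (∈-++⁺ʳ (FVTy A) z∈)))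

DistinctNames-snoc : ∀ {Γ z B} → DistinctNames Γ → All (λ d → proj₁ d ≢ z) Γ →
  DistinctNames (Γ ++ [ (z , B) ])
DistinctNames-snoc Γ! z-new = AllPairs.++⁺ Γ! ([] ∷ []) (All.map (_∷ []) z-new)

⊢ps⇒DistinctNames : ∀ {Γ x A} → Γ ⊢ps x ∶ A → DistinctNames Γ
⊢ps⇒DistinctNames (ps-init x) = [] ∷ []
⊢ps⇒DistinctNames (ps-ext {Γ} y f d y∉ f∉ y≢f) =
  DistinctNames-snoc
    (DistinctNames-snoc (⊢ps⇒DistinctNames d) (fresh⇒names-≢ Γ y∉))
    (++⁺ (fresh⇒names-≢ Γ f∉) (y≢f ∷ []))
⊢ps⇒DistinctNames (ps-tgt d) = ⊢ps⇒DistinctNames d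

mainTheorem12 : (Γ : Ctx) → Γ ⊢ps → (i j : Fin (length Γ)) →
    proj₁ (lookup Γ i) ≡ proj₁ (lookup Γ j) → i ≡ j
mainTheorem12 Γ (ps-done d) = lookup-injective proj₁ (⊢ps⇒DistinctNames d)
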